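{- Let $n,k,o,g$ be positive integers with $o\le n$, let $t_1=1/\binom{n}{o}$ and $t_k=1/\binom{n+(k-1)g}{o}$, and let $\delta>0$. If the relative error between $t_1$ and $t_k$ is $\delta$, then the relative error between $\sum_{i=0}^{k-1}\frac{1}{\binom{n+ig}{o}}$ and $k\sqrt{t_1t_k}$ is at most $\frac{\delta}{2}+\frac{\delta^2}{8}$.
   Context: The relative error between nonzero real numbers $a$ and $b$ is $\frac{|a-b|}{\min(|a|,|b|)}$. -}

module Defs where

open import Data.Nat using (ℕ; zero; suc)
import Data.Nat as ℕ
open import Data.Nat.Combinatorics using (_C_)
open import Data.Integer using (+_)
open import Data.Rational using (ℚ; 0ℚ; 1ℚ; _/_; _+_; _*_; _-_; ∣_∣; _⊓_; _≤_)
open import Data.Product using (_×_)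
open import Relation.Binary.PropositionalEquality using (_≡_)

-- reciprocal of a natural number as a rational (1/0 := 0, never used here
-- since the binomials involved are positive when o ≤ n)
recip : ℕ → ℚ
recip zero    = 0ℚ
recip (suc m) = + 1 / suc m

ℕ→ℚ : ℕ → ℚ
ℕ→ℚ m = + m / 1

-- t i = 1 / binom(n + i g, o)   (so t_1 of the paper is t 0, t_k is t (k-1))
t : (n o g i : ℕ) → ℚ
t n o g i = recip ((n ℕ.+ i ℕ.* g) C o)

sumT : (n o g k : ℕ) → ℚ
sumT n o g zero    = 0ℚ
sumT n o g (suc k) = sumT n o g k + t n o g k

-- "the relative error between a and b is δ":  |a-b| / min(|a|,|b|) = δ,
-- written with the division cleared (a, b nonzero).
RelErrIs : ℚ → ℚ → ℚ → Set
RelErrIs a b δ = ∣ a - b ∣ ≡ δ * (∣ a ∣ ⊓ ∣ b ∣)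

-- "the relative error between S and √y is at most ε", for S > 0, y > 0, ε ≥ 0.
-- |S - √y| ≤ ε·min(S,√y)  ⇔  S ≤ (1+ε)√y ∧ √y ≤ (1+ε)S
--                         ⇔  S² ≤ (1+ε)² y ∧ y ≤ (1+ε)² S²   (all quantities positive)
RelErrSqrtLe : (S y ε : ℚ) → Set
RelErrSqrtLe S y ε =
  (S * S ≤ ((1ℚ + ε) * (1ℚ + ε)) * y) × (y ≤ ((1ℚ + ε) * (1ℚ + ε)) * (S * S))

-- Since t is decreasing in i, writing a = t_1 and b = t_k we have b ≤ t_i ≤ a, so the sum S lies
-- between k b and k a, and the relative-error hypothesis says a = (1 + δ) b. Hence
-- S² ≤ k² a² = (1 + δ) k² a b and k² a b = (1 + δ) k² b² ≤ (1 + δ) S², and the claim follows from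
-- 1 + δ ≤ (1 + δ/2 + δ²/8)², the difference being (δ/2)² + (δ/2 + δ²/8)².
module Submission where

open import Defs
open import Data.Nat using (ℕ; zero; suc; NonZero; z≤n)
import Data.Nat as ℕ
import Data.Nat.Properties as ℕₚ
open import Data.Nat.Combinatorics using (_C_; nCk+nC[k+1]≡[n+1]C[k+1])
open import Data.Integer using (+_)
import Data.Integer as ℤ
import Data.Integer.Properties as ℤₚ
import Data.Nat.Coprimality as Coprimality
open import Data.Rational
  using (ℚ; mkℚ; 0ℚ; 1ℚ; ½; _/_; _+_; _*_; _-_; -_; ∣_∣; _⊓_; _≤_; _<_; *≤*; nonNegative; nonPositive)
open import Data.Rational.Properties
open import Data.Rational.Solver using (module +-*-Solver)
open import Data.Product using (_×_; _,_)
open import Data.Sum using (inj₁; inj₂)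
open import Relation.Binary.PropositionalEquality using (_≡_; refl; sym; trans; cong; cong₂; subst; module ≡-Reasoning)

open +-*-Solver

C-≤-suc : ∀ m k → m C k ℕ.≤ suc m C k
C-≤-suc m zero    = ℕₚ.≤-refl
C-≤-suc m (suc k) = subst (m C suc k ℕ.≤_) (nCk+nC[k+1]≡[n+1]C[k+1] m k) (ℕₚ.m≤n+m _ _)

C-monoˡ-≤ : ∀ {m m'} k → m ℕ.≤ m' → m C k ℕ.≤ m' C k
C-monoˡ-≤ k m≤m' = go (ℕₚ.≤⇒≤′ m≤m')
  where
  go : ∀ {m m'} → m ℕ.≤′ m' → m C k ℕ.≤ m' C k
  go ℕ.≤′-refl     = ℕₚ.≤-refl
  go (ℕ.≤′-step p) = ℕₚ.≤-trans (go p) (C-≤-suc _ k)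

C-pos : ∀ m k → k ℕ.≤ m → 0 ℕ.< m C k
C-pos m       zero    _             = ℕₚ.≤-refl
C-pos (suc m) (suc k) (ℕ.s≤s k≤m) =
  subst (0 ℕ.<_) (nCk+nC[k+1]≡[n+1]C[k+1] m k) (ℕₚ.<-≤-trans (C-pos m k k≤m) (ℕₚ.m≤m+n _ _))

recip-suc≡mkℚ : ∀ m → recip (suc m) ≡ mkℚ (+ 1) m (Coprimality.1-coprimeTo (suc m))
recip-suc≡mkℚ m = normalize-coprime (Coprimality.1-coprimeTo (suc m))

recip-pos : ∀ {m} → 0 ℕ.< m → 0ℚ < recip m
recip-pos {suc m} _ rewrite recip-suc≡mkℚ m = positive⁻¹ _

recip-antitone : ∀ {m m'} → 0 ℕ.< m → m ℕ.≤ m' → recip m' ≤ recip m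
recip-antitone {suc m} {suc m'} _ m≤m' rewrite recip-suc≡mkℚ m | recip-suc≡mkℚ m' =
  *≤* (ℤ.+≤+ (ℕₚ.*-monoʳ-≤ 1 m≤m'))

ℕ→ℚ≡mkℚ : ∀ m → ℕ→ℚ m ≡ mkℚ (+ m) 0 (Coprimality.sym (Coprimality.1-coprimeTo m))
ℕ→ℚ≡mkℚ m = normalize-coprime (Coprimality.sym (Coprimality.1-coprimeTo m))

ℕ→ℚ-nonNeg : ∀ m → 0ℚ ≤ ℕ→ℚ m
ℕ→ℚ-nonNeg m rewrite ℕ→ℚ≡mkℚ m = nonNegative⁻¹ _

ℕ→ℚ-suc : ∀ m → ℕ→ℚ (suc m) ≡ ℕ→ℚ m + 1ℚ
ℕ→ℚ-suc m rewrite ℕ→ℚ≡mkℚ m = /-cong {p₂ = + m ℤ.* + 1 ℤ.+ + 1 ℤ.* + 1} {q₂ = 1} numerators refl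
  where
  numerators : + suc m ≡ + m ℤ.* + 1 ℤ.+ + 1 ℤ.* + 1
  numerators = trans (cong +_ (ℕₚ.+-comm 1 m)) (cong (ℤ._+ + 1) (sym (ℤₚ.*-identityʳ (+ m))))

[n+ig]Co-pos : ∀ {n o} g i → o ℕ.≤ n → 0 ℕ.< (n ℕ.+ i ℕ.* g) C o
[n+ig]Co-pos {n} {o} g i o≤n = C-pos (n ℕ.+ i ℕ.* g) o (ℕₚ.≤-trans o≤n (ℕₚ.m≤m+n n _))

t-pos : ∀ {n o} g i → o ℕ.≤ n → 0ℚ < t n o g i
t-pos g i o≤n = recip-pos ([n+ig]Co-pos g i o≤n)

t-antitone : ∀ {n o} g i j → o ℕ.≤ n → i ℕ.≤ j → t n o g j ≤ t n o g i
t-antitone {n} {o} g i j o≤n i≤j =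
  recip-antitone ([n+ig]Co-pos g i o≤n) (C-monoˡ-≤ o (ℕₚ.+-monoʳ-≤ n (ℕₚ.*-monoˡ-≤ g i≤j)))

ℕ→ℚ-suc-* : ∀ m x → ℕ→ℚ (suc m) * x ≡ ℕ→ℚ m * x + x
ℕ→ℚ-suc-* m x rewrite ℕ→ℚ-suc m = solve 2 (λ K x → (K :+ con 1ℚ) :* x := K :* x :+ x) refl (ℕ→ℚ m) x

sumT-lowerBound : ∀ {n o g} k {b} → (∀ i → i ℕ.< k → b ≤ t n o g i) → ℕ→ℚ k * b ≤ sumT n o g k
sumT-lowerBound zero    {b} _     = ≤-reflexive (*-zeroˡ b)
sumT-lowerBound (suc k) {b} b≤t =
  subst (_≤ _) (sym (ℕ→ℚ-suc-* k b))
        (+-mono-≤ (sumT-lowerBound k (λ i i<k → b≤t i (ℕₚ.m<n⇒m<1+n i<k))) (b≤t k ℕₚ.≤-refl))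

sumT-upperBound : ∀ {n o g} k {a} → (∀ i → i ℕ.< k → t n o g i ≤ a) → sumT n o g k ≤ ℕ→ℚ k * a
sumT-upperBound zero    {a} _     = ≤-reflexive (sym (*-zeroˡ a))
sumT-upperBound (suc k) {a} t≤a =
  subst (_ ≤_) (sym (ℕ→ℚ-suc-* k a))
        (+-mono-≤ (sumT-upperBound k (λ i i<k → t≤a i (ℕₚ.m<n⇒m<1+n i<k))) (t≤a k ℕₚ.≤-refl))

relErrIs⇒≡ : ∀ {a b δ} → 0ℚ ≤ b → b ≤ a → RelErrIs a b δ → a ≡ (1ℚ + δ) * b
relErrIs⇒≡ {a} {b} {δ} 0≤b b≤a ∣a-b∣≡δ*min = begin
  a                ≡⟨ solve 2 (λ a b → a := b :+ (a :- b)) refl a b ⟩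
  b + (a - b)      ≡⟨ cong (λ x → b + x) a-b≡δ*b ⟩
  b + δ * b        ≡⟨ solve 2 (λ b δ → b :+ δ :* b := (con 1ℚ :+ δ) :* b) refl b δ ⟩
  (1ℚ + δ) * b     ∎
  where
  open ≡-Reasoning
  0≤a-b : 0ℚ ≤ a - b
  0≤a-b = subst (_≤ a - b) (+-inverseʳ b) (+-monoˡ-≤ (- b) b≤a)
  a-b≡δ*b : a - b ≡ δ * b
  a-b≡δ*b = begin
    a - b                ≡⟨ sym (0≤p⇒∣p∣≡p 0≤a-b) ⟩
    ∣ a - b ∣            ≡⟨ ∣a-b∣≡δ*min ⟩
    δ * (∣ a ∣ ⊓ ∣ b ∣)  ≡⟨ cong₂ (λ x y → δ * (x ⊓ y)) (0≤p⇒∣p∣≡p (≤-trans 0≤b b≤a)) (0≤p⇒∣p∣≡p 0≤b) ⟩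
    δ * (a ⊓ b)          ≡⟨ cong (δ *_) (p≥q⇒p⊓q≡q b≤a) ⟩
    δ * b                ∎

*-nonNeg : ∀ {p q} → 0ℚ ≤ p → 0ℚ ≤ q → 0ℚ ≤ p * q
*-nonNeg {p} {q} 0≤p 0≤q = nonNegative⁻¹ _ {{nonNeg*nonNeg⇒nonNeg p {{nonNegative 0≤p}} q {{nonNegative 0≤q}}}}

square-nonNeg : ∀ p → 0ℚ ≤ p * p
square-nonNeg p with ≤-total 0ℚ p
... | inj₁ 0≤p = *-nonNeg 0≤p 0≤p
-- despite its name, nonPos*nonPos⇒nonPos concludes NonNegative
... | inj₂ p≤0 = nonNegative⁻¹ _ {{nonPos*nonPos⇒nonPos p {{nonPositive p≤0}} p {{nonPositive p≤0}}}}

square-mono-≤ : ∀ {p q} → 0ℚ ≤ p → p ≤ q → p * p ≤ q * q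
square-mono-≤ {p} {q} 0≤p p≤q =
  ≤-trans (*-monoˡ-≤-nonNeg p {{nonNegative 0≤p}} p≤q)
          (*-monoʳ-≤-nonNeg q {{nonNegative (≤-trans 0≤p p≤q)}} p≤q)

p≤p+q : ∀ p {q} → 0ℚ ≤ q → p ≤ p + q
p≤p+q p {q} 0≤q = subst (_≤ p + q) (+-identityʳ p) (+-monoʳ-≤ p 0≤q)

1+δ≤[1+δ/2+δ²/8]² : ∀ δ → 1ℚ + δ ≤ (1ℚ + (δ * ½ + (δ * δ) * (+ 1 / 8))) * (1ℚ + (δ * ½ + (δ * δ) * (+ 1 / 8)))
1+δ≤[1+δ/2+δ²/8]² δ =
  subst (1ℚ + δ ≤_) (sym expand)
        (p≤p+q (1ℚ + δ) (+-mono-≤ (square-nonNeg (δ * ½)) (square-nonNeg ε)))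
  where
  ε : ℚ
  ε = δ * ½ + (δ * δ) * (+ 1 / 8)
  expand : (1ℚ + ε) * (1ℚ + ε) ≡ (1ℚ + δ) + ((δ * ½) * (δ * ½) + ε * ε)
  expand = solve 1 (λ δ → let e = δ :* con ½ :+ (δ :* δ) :* con (+ 1 / 8) in
                     (con 1ℚ :+ e) :* (con 1ℚ :+ e) := (con 1ℚ :+ δ) :+ ((δ :* con ½) :* (δ :* con ½) :+ e :* e))
                   refl δ

relErrSqrtLe-sandwich : ∀ {a b K S δ ε} → 0ℚ ≤ b → 0ℚ ≤ K → 0ℚ ≤ δ → 1ℚ + δ ≤ (1ℚ + ε) * (1ℚ + ε)
  → a ≡ (1ℚ + δ) * b → K * b ≤ S → S ≤ K * a → RelErrSqrtLe S ((K * K) * (a * b)) ε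
relErrSqrtLe-sandwich {b = b} {K} {S} {δ} {ε} 0≤b 0≤K 0≤δ 1+δ≤E refl Kb≤S S≤Ka = upper , lower
  where
  open ≤-Reasoning
  a E X : ℚ
  a = (1ℚ + δ) * b
  E = (1ℚ + ε) * (1ℚ + ε)
  X = (K * K) * (a * b)
  0≤Kb : 0ℚ ≤ K * b
  0≤Kb = *-nonNeg 0≤K 0≤b
  0≤X : 0ℚ ≤ X
  0≤X = *-nonNeg (square-nonNeg K) (*-nonNeg (*-nonNeg (+-mono-≤ (nonNegative⁻¹ 1ℚ) 0≤δ) 0≤b) 0≤b)
  upper : S * S ≤ E * X
  upper = begin
    S * S                ≤⟨ square-mono-≤ (≤-trans 0≤Kb Kb≤S) S≤Ka ⟩
    (K * a) * (K * a)    ≡⟨ solve 3 (λ b δ K → (K :* ((con 1ℚ :+ δ) :* b)) :* (K :* ((con 1ℚ :+ δ) :* b))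
                                      := (con 1ℚ :+ δ) :* ((K :* K) :* (((con 1ℚ :+ δ) :* b) :* b))) refl b δ K ⟩
    (1ℚ + δ) * X         ≤⟨ *-monoʳ-≤-nonNeg X {{nonNegative 0≤X}} 1+δ≤E ⟩
    E * X                ∎
  lower : X ≤ E * (S * S)
  lower = begin
    X                                ≡⟨ solve 3 (λ b δ K → (K :* K) :* (((con 1ℚ :+ δ) :* b) :* b)
                                                  := (con 1ℚ :+ δ) :* ((K :* b) :* (K :* b))) refl b δ K ⟩
    (1ℚ + δ) * ((K * b) * (K * b))   ≤⟨ *-monoʳ-≤-nonNeg _ {{nonNegative (*-nonNeg 0≤Kb 0≤Kb)}} 1+δ≤E ⟩
    E * ((K * b) * (K * b))          ≤⟨ *-monoˡ-≤-nonNeg E {{nonNegative (square-nonNeg (1ℚ + ε))}} (square-mono-≤ 0≤Kb Kb≤S) ⟩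
    E * (S * S)                      ∎

lemma37 : (n k o g : ℕ) → .{{_ : NonZero n}} → .{{_ : NonZero k}} → .{{_ : NonZero o}} → .{{_ : NonZero g}}
    → o ℕ.≤ n → (δ : ℚ) → 0ℚ < δ
    → RelErrIs (t n o g 0) (t n o g (k ℕ.∸ 1)) δ
    → RelErrSqrtLe (sumT n o g k) ((ℕ→ℚ k * ℕ→ℚ k) * (t n o g 0 * t n o g (k ℕ.∸ 1))) (δ * ½ + (δ * δ) * (+ 1 / 8))
lemma37 n k o g o≤n δ 0<δ relErr =
  relErrSqrtLe-sandwich {δ = δ} {ε = δ * ½ + (δ * δ) * (+ 1 / 8)}
    0≤tₖ (ℕ→ℚ-nonNeg k) (<⇒≤ 0<δ) (1+δ≤[1+δ/2+δ²/8]² δ) t₁≡[1+δ]tₖ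
    (sumT-lowerBound k (λ i i<k → t-antitone g i (k ℕ.∸ 1) o≤n (ℕₚ.∸-monoˡ-≤ 1 i<k)))
    (sumT-upperBound k (λ i _ → t-antitone g 0 i o≤n z≤n))
  where
  0≤tₖ : 0ℚ ≤ t n o g (k ℕ.∸ 1)
  0≤tₖ = <⇒≤ (t-pos g (k ℕ.∸ 1) o≤n)
  t₁≡[1+δ]tₖ : t n o g 0 ≡ (1ℚ + δ) * t n o g (k ℕ.∸ 1)
  t₁≡[1+δ]tₖ = relErrIs⇒≡ {δ = δ} 0≤tₖ (t-antitone g 0 (k ℕ.∸ 1) o≤n z≤n) relErr
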